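{- For every natural number $n$, the following identity holds in the ring $\mathsf{Sym}$ of symmetric functions over $\mathbb{Q}$: $$\sum_{i=0}^{2n} (-1)^i (n-i)\, s_{(2n+1-i,\,1^{i})} \;=\; \sum_{i=1}^{n} p_{(2n+1-i,\,i)} \;=\; \sum_{i=1}^{n} p_{2n+1-i}\,p_{i}.$$
   Context: $\mathsf{Sym}$ denotes the algebra of symmetric functions over $\mathbb{Q}$ in countably many indeterminates $x_1,x_2,\ldots$. For $k\ge 1$, $p_k=\sum_{j\ge 1}x_j^k$ is the $k$-th power sum symmetric function, and for a partition $\mu=(\mu_1,\ldots,\mu_\ell)$, $p_\mu=p_{\mu_1}\cdots p_{\mu_\ell}$. For a partition $\lambda$, $s_\lambda$ denotes the Schur function indexed by $\lambda$ (e.g. given by the Jacobi–Trudi determinant $s_\lambda=\det(h_{\lambda_i-i+j})$, where $h_k$ is the complete homogeneous symmetric function and $h_k=0$ for $k<0$). For integers $a\ge 1$, $b\ge 0$, $(a,1^{b})$ denotes the hook partition $(a,1,1,\ldots,1)$ with $b$ parts equal to $1$ after the first part $a$. -}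

module Defs where

open import Data.Nat as ℕ using (ℕ; zero; suc)
open import Data.Integer as ℤ using (ℤ; +_; -[1+_])
open import Data.Fin using (Fin; zero; suc; toℕ; punchIn)
open import Data.List using (List; []; _∷_; length; replicate; lookup)
open import Data.Rational using (ℚ; 0ℚ; 1ℚ; _+_; _*_; -_; _/_)

pow : ℚ → ℕ → ℚ
pow x zero    = 1ℚ
pow x (suc k) = x * pow x k

sign : ℕ → ℚ
sign zero    = 1ℚ
sign (suc i) = - sign i

ℤ→ℚ : ℤ → ℚ
ℤ→ℚ z = z / 1

sumBelow : ℕ → (ℕ → ℚ) → ℚ
sumBelow zero    f = 0ℚ
sumBelow (suc m) f = sumBelow m f + f m

sumFin : (n : ℕ) → (Fin n → ℚ) → ℚ
sumFin zero    f = 0ℚ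
sumFin (suc n) f = f zero + sumFin n (λ j → f (suc j))

-- Σ_{i=a}^{b} f i  (empty if b < a)
sumFromTo : ℕ → ℕ → (ℕ → ℚ) → ℚ
sumFromTo a b f = sumBelow (suc b ℕ.∸ a) (λ k → f (a ℕ.+ k))

det : (n : ℕ) → (Fin n → Fin n → ℚ) → ℚ
det zero    M = 1ℚ
det (suc n) M =
  sumFin (suc n) (λ j → sign (toℕ j) * (M zero j * det n (λ r c → M (suc r) (punchIn j c))))

-- Symmetric polynomials in N variables x : Fin N → ℚ, evaluated at x.
-- power sum p_k(x) = Σ_j x_j^k
p : ℕ → {N : ℕ} → (Fin N → ℚ) → ℚ
p k {N} x = sumFin N (λ j → pow (x j) k)

pPart : List ℕ → {N : ℕ} → (Fin N → ℚ) → ℚ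
pPart []      x = 1ℚ
pPart (m ∷ μ) x = p m x * pPart μ x

h : ℕ → {N : ℕ} → (Fin N → ℚ) → ℚ
h zero    {zero}  x = 1ℚ
h (suc k) {zero}  x = 0ℚ
h k       {suc N} x = sumBelow (suc k) (λ j → pow (x zero) j * h (k ℕ.∸ j) (λ i → x (suc i)))

hℤ : ℤ → {N : ℕ} → (Fin N → ℚ) → ℚ
hℤ (+ k)    x = h k x
hℤ -[1+ k ] x = 0ℚ

-- Schur function via Jacobi–Trudi: s_λ = det (h_{λ_i - i + j})_{1≤i,j≤ℓ(λ)}
s : (λ' : List ℕ) → {N : ℕ} → (Fin N → ℚ) → ℚ
s λ' x = det (length λ')
  (λ i j → hℤ ((+ lookup λ' i ℤ.- + toℕ i) ℤ.+ + toℕ j) x)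

hook : ℕ → ℕ → List ℕ
hook a b = a ∷ replicate b 1

{-# OPTIONS --safe #-}
module Submission where

-- Let H, A and P be the sequences h_k, (-1)^k e_k and p_k (with p₀ replaced by 0), multiplied as
-- power series, and let θ = z d/dz. Expanding the Jacobi–Trudi determinant of a hook along its
-- first row gives (-1)^b s_(a,1^b) = Σ_{l≤b} A_l h_{a+b-l}, and H A = 1. Newton's identities say
-- P H = θH, so P is the logarithmic derivative of H and P² = -(θA)(θH). Summation by parts turns
-- the weights n - i into the tail sums Σ_{i=l}^{2n} (n - i) = -l(2n+1-l)/2, so twice the hook sum
-- is the coefficient of z^{2n+1} in -(θA)(θH) = P², which is twice the right-hand side because
-- 2n+1 is odd.

open import Defs
open import Data.Nat using (ℕ; suc; _+_; _*_; _∸_)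
open import Data.Integer using (+_; _-_)
open import Data.Fin using (Fin)
open import Data.List using (_∷_; [])
open import Data.Rational using (ℚ) renaming (_*_ to _*ℚ_)
open import Data.Product using (_×_)
open import Relation.Binary.PropositionalEquality using (_≡_)

open import Data.Nat using (zero; _<_; _≤_; s≤s)
import Data.Nat.Properties as ℕₚ
import Data.Integer as ℤ
import Data.Integer.Properties as ℤₚ
open import Data.Fin using (zero; suc; toℕ; punchIn)
open import Data.List using (replicate; length; lookup)
open import Data.List.Properties using (length-replicate)
open import Data.Rational using (0ℚ; 1ℚ; _/_; toℚᵘ)
  renaming (_+_ to _+ℚ_; _-_ to _-ℚ_; -_ to -ℚ_)
import Data.Rational.Properties as ℚₚ
open import Data.Rational.Unnormalised using (mkℚᵘ; *≡*) renaming (_≃_ to _≃ᵘ_; _+_ to _+ᵘ_; -_ to -ᵘ_)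
import Data.Rational.Unnormalised.Properties as ℚᵘₚ
open import Data.Product using (_,_)
open import Algebra.Properties.Group ℚₚ.+-0-group using (inverseˡ-unique)
open import Function using (_∘_)
open import Level using (0ℓ)
open import Relation.Binary.PropositionalEquality
  using (refl; sym; trans; cong; cong₂; _≗_; module ≡-Reasoning)
open import Relation.Nullary.Decidable using (dec⇒maybe)
open import Tactic.RingSolver using (solve-∀)
import Data.Integer.Tactic.RingSolver as ℤ-Solver
open import Tactic.RingSolver.Core.AlmostCommutativeRing
  using (AlmostCommutativeRing; fromCommutativeRing)

open ≡-Reasoning

ℚ-ring : AlmostCommutativeRing 0ℓ 0ℓ
ℚ-ring = fromCommutativeRing ℚₚ.+-*-commutativeRing (dec⇒maybe ∘ (0ℚ ℚₚ.≟_))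

toℚᵘ-ℤ→ℚ : ∀ a → toℚᵘ (ℤ→ℚ a) ≃ᵘ mkℚᵘ a 0
toℚᵘ-ℤ→ℚ a = ℚₚ.toℚᵘ-fromℚᵘ (mkℚᵘ a 0)

ℤ→ℚ-homo-+ : ∀ a b → ℤ→ℚ (a ℤ.+ b) ≡ ℤ→ℚ a +ℚ ℤ→ℚ b
ℤ→ℚ-homo-+ a b = ℚₚ.toℚᵘ-injective (begin≃
  toℚᵘ (ℤ→ℚ (a ℤ.+ b))             ≈⟨ toℚᵘ-ℤ→ℚ (a ℤ.+ b) ⟩
  mkℚᵘ (a ℤ.+ b) 0                 ≈⟨ *≡* ℤ-identity ⟨
  mkℚᵘ a 0 +ᵘ mkℚᵘ b 0             ≈⟨ ℚᵘₚ.+-cong (toℚᵘ-ℤ→ℚ a) (toℚᵘ-ℤ→ℚ b) ⟨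
  toℚᵘ (ℤ→ℚ a) +ᵘ toℚᵘ (ℤ→ℚ b)     ≈⟨ ℚₚ.toℚᵘ-homo-+ (ℤ→ℚ a) (ℤ→ℚ b) ⟨
  toℚᵘ (ℤ→ℚ a +ℚ ℤ→ℚ b)            ∎≃)
  where
  open ℚᵘₚ.≃-Reasoning renaming (begin_ to begin≃_; _∎ to _∎≃)
  ℤ-identity : (a ℤ.* + 1 ℤ.+ b ℤ.* + 1) ℤ.* + 1 ≡ (a ℤ.+ b) ℤ.* + 1
  ℤ-identity = trans (ℤₚ.*-identityʳ _)
    (trans (cong₂ ℤ._+_ (ℤₚ.*-identityʳ a) (ℤₚ.*-identityʳ b)) (sym (ℤₚ.*-identityʳ (a ℤ.+ b))))

ℤ→ℚ-homo‿- : ∀ a → ℤ→ℚ (ℤ.- a) ≡ -ℚ ℤ→ℚ a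
ℤ→ℚ-homo‿- a = ℚₚ.toℚᵘ-injective (begin≃
  toℚᵘ (ℤ→ℚ (ℤ.- a))     ≈⟨ toℚᵘ-ℤ→ℚ (ℤ.- a) ⟩
  -ᵘ mkℚᵘ a 0            ≈⟨ ℚᵘₚ.-‿cong (toℚᵘ-ℤ→ℚ a) ⟨
  -ᵘ toℚᵘ (ℤ→ℚ a)        ≈⟨ ℚₚ.toℚᵘ-homo‿- (ℤ→ℚ a) ⟨
  toℚᵘ (-ℚ ℤ→ℚ a)        ∎≃)
  where open ℚᵘₚ.≃-Reasoning renaming (begin_ to begin≃_; _∎ to _∎≃)

ℕ→ℚ : ℕ → ℚ
ℕ→ℚ k = ℤ→ℚ (+ k)

ℕ→ℚ-homo-+ : ∀ m n → ℕ→ℚ (m + n) ≡ ℕ→ℚ m +ℚ ℕ→ℚ n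
ℕ→ℚ-homo-+ m n = ℤ→ℚ-homo-+ (+ m) (+ n)

ℤ→ℚ-homo-− : ∀ m n → ℤ→ℚ (+ m - + n) ≡ ℕ→ℚ m -ℚ ℕ→ℚ n
ℤ→ℚ-homo-− m n = trans (ℤ→ℚ-homo-+ (+ m) (ℤ.- + n)) (cong (ℕ→ℚ m +ℚ_) (ℤ→ℚ-homo‿- (+ n)))

ℕ→ℚ-homo-∸ : ∀ {m n} → n ≤ m → ℕ→ℚ (m ∸ n) ≡ ℕ→ℚ m -ℚ ℕ→ℚ n
ℕ→ℚ-homo-∸ {m} {n} n≤m = begin
  ℕ→ℚ (m ∸ n)                      ≡⟨ x≡[y+x]-y (ℕ→ℚ (m ∸ n)) (ℕ→ℚ n) ⟩
  (ℕ→ℚ n +ℚ ℕ→ℚ (m ∸ n)) -ℚ ℕ→ℚ n  ≡⟨ cong (_-ℚ ℕ→ℚ n) (ℕ→ℚ-homo-+ n (m ∸ n)) ⟨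
  ℕ→ℚ (n + (m ∸ n)) -ℚ ℕ→ℚ n       ≡⟨ cong (λ k → ℕ→ℚ k -ℚ ℕ→ℚ n) (ℕₚ.m+[n∸m]≡n n≤m) ⟩
  ℕ→ℚ m -ℚ ℕ→ℚ n                   ∎
  where
  x≡[y+x]-y : ∀ x y → x ≡ (y +ℚ x) -ℚ y
  x≡[y+x]-y = solve-∀ ℚ-ring

sign-homo-+ : ∀ a b → sign (a + b) ≡ sign a *ℚ sign b
sign-homo-+ zero    b = sym (ℚₚ.*-identityˡ (sign b))
sign-homo-+ (suc a) b = trans (cong -ℚ_ (sign-homo-+ a b)) (ℚₚ.neg-distribˡ-* (sign a) (sign b))

sign-square : ∀ a → sign a *ℚ sign a ≡ 1ℚ
sign-square zero    = refl
sign-square (suc a) = trans (neg*neg (sign a)) (sign-square a)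
  where
  neg*neg : ∀ s → (-ℚ s) *ℚ (-ℚ s) ≡ s *ℚ s
  neg*neg = solve-∀ ℚ-ring

sign-∸ : ∀ {j k} → j ≤ k → sign k *ℚ sign j ≡ sign (k ∸ j)
sign-∸ {j} {k} j≤k = begin
  sign k *ℚ sign j                       ≡⟨ cong (λ t → sign t *ℚ sign j) (ℕₚ.m+[n∸m]≡n j≤k) ⟨
  sign (j + (k ∸ j)) *ℚ sign j           ≡⟨ cong (_*ℚ sign j) (sign-homo-+ j (k ∸ j)) ⟩
  (sign j *ℚ sign (k ∸ j)) *ℚ sign j     ≡⟨ regroup (sign j) (sign (k ∸ j)) ⟩
  (sign j *ℚ sign j) *ℚ sign (k ∸ j)     ≡⟨ cong (_*ℚ sign (k ∸ j)) (sign-square j) ⟩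
  1ℚ *ℚ sign (k ∸ j)                     ≡⟨ ℚₚ.*-identityˡ (sign (k ∸ j)) ⟩
  sign (k ∸ j)                           ∎
  where
  regroup : ∀ s t → (s *ℚ t) *ℚ s ≡ (s *ℚ s) *ℚ t
  regroup = solve-∀ ℚ-ring

double-injective : ∀ {a b} → a +ℚ a ≡ b +ℚ b → a ≡ b
double-injective {a} {b} eq = trans (halve a) (trans (cong (½ *ℚ_) eq) (sym (halve b)))
  where
  ½ : ℚ
  ½ = + 1 / 2
  halve : ∀ x → x ≡ ½ *ℚ (x +ℚ x)
  halve = solve-∀ ℚ-ring

sumBelow-cong : ∀ n {f g : ℕ → ℚ} → (∀ i → i < n → f i ≡ g i) → sumBelow n f ≡ sumBelow n g
sumBelow-cong zero    eq = refl
sumBelow-cong (suc n) eq = cong₂ _+ℚ_ (sumBelow-cong n (λ i i<n → eq i (ℕₚ.m<n⇒m<1+n i<n))) (eq n ℕₚ.≤-refl)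

sumBelow-+ : ∀ n (f g : ℕ → ℚ) → sumBelow n (λ i → f i +ℚ g i) ≡ sumBelow n f +ℚ sumBelow n g
sumBelow-+ zero    f g = refl
sumBelow-+ (suc n) f g = trans (cong (_+ℚ (f n +ℚ g n)) (sumBelow-+ n f g))
  (interchange (sumBelow n f) (sumBelow n g) (f n) (g n))
  where
  interchange : ∀ a b c d → (a +ℚ b) +ℚ (c +ℚ d) ≡ (a +ℚ c) +ℚ (b +ℚ d)
  interchange = solve-∀ ℚ-ring

*-distribˡ-sumBelow : ∀ n c (f : ℕ → ℚ) → c *ℚ sumBelow n f ≡ sumBelow n (λ i → c *ℚ f i)
*-distribˡ-sumBelow zero    c f = ℚₚ.*-zeroʳ c
*-distribˡ-sumBelow (suc n) c f =
  trans (ℚₚ.*-distribˡ-+ c (sumBelow n f) (f n)) (cong (_+ℚ c *ℚ f n) (*-distribˡ-sumBelow n c f))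

sumBelow-neg : ∀ n (f : ℕ → ℚ) → sumBelow n (λ i → -ℚ f i) ≡ -ℚ sumBelow n f
sumBelow-neg zero    f = refl
sumBelow-neg (suc n) f =
  trans (cong (_+ℚ -ℚ f n) (sumBelow-neg n f)) (sym (ℚₚ.neg-distrib-+ (sumBelow n f) (f n)))

sumBelow-suc : ∀ n (f : ℕ → ℚ) → sumBelow (suc n) f ≡ f 0 +ℚ sumBelow n (f ∘ suc)
sumBelow-suc zero    f = trans (ℚₚ.+-identityˡ (f 0)) (sym (ℚₚ.+-identityʳ (f 0)))
sumBelow-suc (suc n) f =
  trans (cong (_+ℚ f (suc n)) (sumBelow-suc n f)) (ℚₚ.+-assoc (f 0) (sumBelow n (f ∘ suc)) (f (suc n)))

sumBelow-split : ∀ a b (f : ℕ → ℚ) → sumBelow (a + b) f ≡ sumBelow a f +ℚ sumBelow b (λ k → f (a + k))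
sumBelow-split a zero    f = trans (cong (λ t → sumBelow t f) (ℕₚ.+-identityʳ a)) (sym (ℚₚ.+-identityʳ _))
sumBelow-split a (suc b) f = begin
  sumBelow (a + suc b) f
    ≡⟨ cong (λ t → sumBelow t f) (ℕₚ.+-suc a b) ⟩
  sumBelow (a + b) f +ℚ f (a + b)
    ≡⟨ cong (_+ℚ f (a + b)) (sumBelow-split a b f) ⟩
  (sumBelow a f +ℚ sumBelow b (λ k → f (a + k))) +ℚ f (a + b)
    ≡⟨ ℚₚ.+-assoc (sumBelow a f) _ _ ⟩
  sumBelow a f +ℚ sumBelow (suc b) (λ k → f (a + k))
    ∎

sumBelow-reverse : ∀ n (f : ℕ → ℚ) → sumBelow n f ≡ sumBelow n (λ i → f (n ∸ suc i))
sumBelow-reverse zero    f = refl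
sumBelow-reverse (suc n) f = begin
  sumBelow n f +ℚ f n                                 ≡⟨ cong (_+ℚ f n) (sumBelow-reverse n f) ⟩
  sumBelow n (λ i → f (n ∸ suc i)) +ℚ f n             ≡⟨ ℚₚ.+-comm _ (f n) ⟩
  f n +ℚ sumBelow n (λ i → f (n ∸ suc i))             ≡⟨ sumBelow-suc n (λ i → f (n ∸ i)) ⟨
  sumBelow (suc n) (λ i → f (suc n ∸ suc i))          ∎

sumBelow-const : ∀ n c → sumBelow n (λ _ → c) ≡ ℕ→ℚ n *ℚ c
sumBelow-const zero    c = sym (ℚₚ.*-zeroˡ c)
sumBelow-const (suc n) c = begin
  sumBelow n (λ _ → c) +ℚ c    ≡⟨ cong (_+ℚ c) (sumBelow-const n c) ⟩
  ℕ→ℚ n *ℚ c +ℚ c              ≡⟨ distrib (ℕ→ℚ n) c ⟩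
  (1ℚ +ℚ ℕ→ℚ n) *ℚ c           ≡⟨ cong (_*ℚ c) (ℕ→ℚ-homo-+ 1 n) ⟨
  ℕ→ℚ (suc n) *ℚ c             ∎
  where
  distrib : ∀ a c → a *ℚ c +ℚ c ≡ (1ℚ +ℚ a) *ℚ c
  distrib = solve-∀ ℚ-ring

sumBelow-zero : ∀ n {f : ℕ → ℚ} → (∀ i → i < n → f i ≡ 0ℚ) → sumBelow n f ≡ 0ℚ
sumBelow-zero n eq = trans (sumBelow-cong n eq) (trans (sumBelow-const n 0ℚ) (ℚₚ.*-zeroʳ (ℕ→ℚ n)))

summation-by-parts : ∀ M (w c : ℕ → ℚ) →
  sumBelow M (λ i → w i *ℚ sumBelow (suc i) c) ≡ sumBelow M (λ l → c l *ℚ (sumBelow M w -ℚ sumBelow l w))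
summation-by-parts zero    w c = refl
summation-by-parts (suc M) w c = begin
  sumBelow M (λ i → w i *ℚ C (suc i)) +ℚ w M *ℚ C (suc M)
    ≡⟨ cong (_+ℚ w M *ℚ C (suc M)) (summation-by-parts M w c) ⟩
  sumBelow M (λ l → c l *ℚ (W M -ℚ W l)) +ℚ w M *ℚ (C M +ℚ c M)
    ≡⟨ regroup (sumBelow M (λ l → c l *ℚ (W M -ℚ W l))) (w M) (C M) (c M) (W M) ⟩
  (sumBelow M (λ l → c l *ℚ (W M -ℚ W l)) +ℚ w M *ℚ C M) +ℚ c M *ℚ (W (suc M) -ℚ W M)
    ≡⟨ cong (_+ℚ c M *ℚ (W (suc M) -ℚ W M)) extend ⟩
  sumBelow M (λ l → c l *ℚ (W (suc M) -ℚ W l)) +ℚ c M *ℚ (W (suc M) -ℚ W M)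
    ∎
  where
  C W : ℕ → ℚ
  C l = sumBelow l c
  W l = sumBelow l w
  regroup : ∀ S a b d V → S +ℚ a *ℚ (b +ℚ d) ≡ (S +ℚ a *ℚ b) +ℚ d *ℚ ((V +ℚ a) -ℚ V)
  regroup = solve-∀ ℚ-ring
  expand : ∀ d V a U → d *ℚ (V -ℚ U) +ℚ a *ℚ d ≡ d *ℚ ((V +ℚ a) -ℚ U)
  expand = solve-∀ ℚ-ring
  extend : sumBelow M (λ l → c l *ℚ (W M -ℚ W l)) +ℚ w M *ℚ C M
         ≡ sumBelow M (λ l → c l *ℚ (W (suc M) -ℚ W l))
  extend = begin
    sumBelow M (λ l → c l *ℚ (W M -ℚ W l)) +ℚ w M *ℚ C M
      ≡⟨ cong (sumBelow M (λ l → c l *ℚ (W M -ℚ W l)) +ℚ_) (*-distribˡ-sumBelow M (w M) c) ⟩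
    sumBelow M (λ l → c l *ℚ (W M -ℚ W l)) +ℚ sumBelow M (λ l → w M *ℚ c l)
      ≡⟨ sumBelow-+ M (λ l → c l *ℚ (W M -ℚ W l)) (λ l → w M *ℚ c l) ⟨
    sumBelow M (λ l → c l *ℚ (W M -ℚ W l) +ℚ w M *ℚ c l)
      ≡⟨ sumBelow-cong M (λ l _ → expand (c l) (W M) (w M) (W l)) ⟩
    sumBelow M (λ l → c l *ℚ (W (suc M) -ℚ W l))
      ∎

sumBelow-palindrome : ∀ a (g : ℕ → ℚ) → (∀ k → k < a → g (a + a ∸ suc k) ≡ g k) →
  sumBelow (a + a) g ≡ sumBelow a g +ℚ sumBelow a g
sumBelow-palindrome a g palindromic = begin
  sumBelow (a + a) g                             ≡⟨ sumBelow-split a a g ⟩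
  sumBelow a g +ℚ sumBelow a (λ k → g (a + k))   ≡⟨ cong (sumBelow a g +ℚ_) secondHalf ⟩
  sumBelow a g +ℚ sumBelow a g                   ∎
  where
  secondHalf : sumBelow a (λ k → g (a + k)) ≡ sumBelow a g
  secondHalf = trans (sumBelow-reverse a (λ k → g (a + k))) (sumBelow-cong a (λ k k<a →
    trans (cong g (sym (ℕₚ.+-∸-assoc a k<a))) (palindromic k k<a)))

twice-Σ[n-i] : ∀ n l → sumBelow l (λ i → ℤ→ℚ (+ n - + i)) +ℚ sumBelow l (λ i → ℤ→ℚ (+ n - + i))
                    ≡ ℕ→ℚ l *ℚ (ℕ→ℚ (suc (2 * n)) -ℚ ℕ→ℚ l)
twice-Σ[n-i] n zero    = sym (ℚₚ.*-zeroˡ (ℕ→ℚ (suc (2 * n)) -ℚ 0ℚ))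
twice-Σ[n-i] n (suc l) = begin
  (W +ℚ w) +ℚ (W +ℚ w)
    ≡⟨ interchange W w ⟩
  (W +ℚ W) +ℚ (w +ℚ w)
    ≡⟨ cong₂ _+ℚ_ (twice-Σ[n-i] n l) (cong (λ t → t +ℚ t) (ℤ→ℚ-homo-− n l)) ⟩
  ℕ→ℚ l *ℚ (ℕ→ℚ (suc (2 * n)) -ℚ ℕ→ℚ l) +ℚ ((ℕ→ℚ n -ℚ ℕ→ℚ l) +ℚ (ℕ→ℚ n -ℚ ℕ→ℚ l))
    ≡⟨ cong (λ t → ℕ→ℚ l *ℚ (t -ℚ ℕ→ℚ l) +ℚ ((ℕ→ℚ n -ℚ ℕ→ℚ l) +ℚ (ℕ→ℚ n -ℚ ℕ→ℚ l))) ℕ→ℚ[1+2n] ⟩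
  ℕ→ℚ l *ℚ ((1ℚ +ℚ (ℕ→ℚ n +ℚ ℕ→ℚ n)) -ℚ ℕ→ℚ l) +ℚ ((ℕ→ℚ n -ℚ ℕ→ℚ l) +ℚ (ℕ→ℚ n -ℚ ℕ→ℚ l))
    ≡⟨ step (ℕ→ℚ n) (ℕ→ℚ l) ⟩
  (1ℚ +ℚ ℕ→ℚ l) *ℚ ((1ℚ +ℚ (ℕ→ℚ n +ℚ ℕ→ℚ n)) -ℚ (1ℚ +ℚ ℕ→ℚ l))
    ≡⟨ cong₂ (λ s t → s *ℚ (t -ℚ s)) (ℕ→ℚ-homo-+ 1 l) ℕ→ℚ[1+2n] ⟨
  ℕ→ℚ (suc l) *ℚ (ℕ→ℚ (suc (2 * n)) -ℚ ℕ→ℚ (suc l))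
    ∎
  where
  W w : ℚ
  W = sumBelow l (λ i → ℤ→ℚ (+ n - + i))
  w = ℤ→ℚ (+ n - + l)
  interchange : ∀ a b → (a +ℚ b) +ℚ (a +ℚ b) ≡ (a +ℚ a) +ℚ (b +ℚ b)
  interchange = solve-∀ ℚ-ring
  step : ∀ ν ℓ → ℓ *ℚ ((1ℚ +ℚ (ν +ℚ ν)) -ℚ ℓ) +ℚ ((ν -ℚ ℓ) +ℚ (ν -ℚ ℓ))
                ≡ (1ℚ +ℚ ℓ) *ℚ ((1ℚ +ℚ (ν +ℚ ν)) -ℚ (1ℚ +ℚ ℓ))
  step = solve-∀ ℚ-ring
  ℕ→ℚ[1+2n] : ℕ→ℚ (suc (2 * n)) ≡ 1ℚ +ℚ (ℕ→ℚ n +ℚ ℕ→ℚ n)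
  ℕ→ℚ[1+2n] = trans (ℕ→ℚ-homo-+ 1 (2 * n))
    (cong (1ℚ +ℚ_) (trans (ℕ→ℚ-homo-+ n (n + 0)) (cong (λ t → ℕ→ℚ n +ℚ ℕ→ℚ t) (ℕₚ.+-identityʳ n))))

sumFin-cong : ∀ n {f g : Fin n → ℚ} → f ≗ g → sumFin n f ≡ sumFin n g
sumFin-cong zero    eq = refl
sumFin-cong (suc n) eq = cong₂ _+ℚ_ (eq zero) (sumFin-cong n (eq ∘ suc))

sumFin-zero : ∀ n {f : Fin n → ℚ} → (∀ j → f j ≡ 0ℚ) → sumFin n f ≡ 0ℚ
sumFin-zero zero    eq = refl
sumFin-zero (suc n) eq = cong₂ _+ℚ_ (eq zero) (sumFin-zero n (eq ∘ suc))

sumFin-toℕ : ∀ n (f : ℕ → ℚ) → sumFin n (f ∘ toℕ) ≡ sumBelow n f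
sumFin-toℕ zero    f = refl
sumFin-toℕ (suc n) f = trans (cong (f 0 +ℚ_) (sumFin-toℕ n (f ∘ suc))) (sym (sumBelow-suc n f))

Seq : Set
Seq = ℕ → ℚ

infixl 7 _∗_

_∗_ : Seq → Seq → Seq
(f ∗ g) k = sumBelow (suc k) (λ j → f j *ℚ g (k ∸ j))

δ : Seq
δ zero    = 1ℚ
δ (suc k) = 0ℚ

shift : Seq → Seq
shift f k = f (suc k)

-- z d/dz on generating functions
θ : Seq → Seq
θ f k = ℕ→ℚ k *ℚ f k

θ-zero : ∀ f → θ f 0 ≡ 0ℚ
θ-zero f = ℚₚ.*-zeroˡ (f 0)

dropConstant : Seq → Seq
dropConstant f zero    = 0ℚ
dropConstant f (suc k) = f (suc k)

dropConstant-pos : ∀ f {j} → 0 < j → dropConstant f j ≡ f j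
dropConstant-pos f {suc j} _ = refl

∗-congˡ : ∀ {f f′} g → f ≗ f′ → f ∗ g ≗ f′ ∗ g
∗-congˡ g f≗f′ k = sumBelow-cong (suc k) (λ j _ → cong (_*ℚ g (k ∸ j)) (f≗f′ j))

∗-congʳ : ∀ f {g g′} → g ≗ g′ → f ∗ g ≗ f ∗ g′
∗-congʳ f g≗g′ k = sumBelow-cong (suc k) (λ j _ → cong (f j *ℚ_) (g≗g′ (k ∸ j)))

∗-suc : ∀ f g k → (f ∗ g) (suc k) ≡ f 0 *ℚ g (suc k) +ℚ (shift f ∗ g) k
∗-suc f g k = sumBelow-suc (suc k) (λ j → f j *ℚ g (suc k ∸ j))

∗-sucʳ : ∀ f g k → (f ∗ g) (suc k) ≡ (f ∗ shift g) k +ℚ f (suc k) *ℚ g 0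
∗-sucʳ f g k = cong₂ _+ℚ_ (sumBelow-cong (suc k) shifted) (cong (λ t → f (suc k) *ℚ g t) (ℕₚ.n∸n≡0 k))
  where
  shifted : ∀ j → j < suc k → f j *ℚ g (suc k ∸ j) ≡ f j *ℚ g (suc (k ∸ j))
  shifted j (s≤s j≤k) = cong (λ t → f j *ℚ g t) (ℕₚ.+-∸-assoc 1 j≤k)

∗-comm : ∀ f g → f ∗ g ≗ g ∗ f
∗-comm f g zero    = cong (0ℚ +ℚ_) (ℚₚ.*-comm (f 0) (g 0))
∗-comm f g (suc k) = begin
  (f ∗ g) (suc k)                          ≡⟨ ∗-suc f g k ⟩
  f 0 *ℚ g (suc k) +ℚ (shift f ∗ g) k      ≡⟨ cong (f 0 *ℚ g (suc k) +ℚ_) (∗-comm (shift f) g k) ⟩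
  f 0 *ℚ g (suc k) +ℚ (g ∗ shift f) k      ≡⟨ ℚₚ.+-comm (f 0 *ℚ g (suc k)) _ ⟩
  (g ∗ shift f) k +ℚ f 0 *ℚ g (suc k)      ≡⟨ cong ((g ∗ shift f) k +ℚ_) (ℚₚ.*-comm (f 0) (g (suc k))) ⟩
  (g ∗ shift f) k +ℚ g (suc k) *ℚ f 0      ≡⟨ ∗-sucʳ g f k ⟨
  (g ∗ f) (suc k)                          ∎

∗-distribʳ-+ : ∀ u v g → (λ i → u i +ℚ v i) ∗ g ≗ λ k → (u ∗ g) k +ℚ (v ∗ g) k
∗-distribʳ-+ u v g k =
  trans (sumBelow-cong (suc k) (λ j _ → ℚₚ.*-distribʳ-+ (g (k ∸ j)) (u j) (v j))) (sumBelow-+ (suc k) _ _)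

∗-scalarˡ : ∀ c u g → (λ i → c *ℚ u i) ∗ g ≗ λ k → c *ℚ (u ∗ g) k
∗-scalarˡ c u g k =
  trans (sumBelow-cong (suc k) (λ j _ → ℚₚ.*-assoc c (u j) (g (k ∸ j))))
    (sym (*-distribˡ-sumBelow (suc k) c _))

∗-negʳ : ∀ f g → f ∗ (λ i → -ℚ g i) ≗ λ k → -ℚ (f ∗ g) k
∗-negʳ f g k =
  trans (sumBelow-cong (suc k) (λ j _ → sym (ℚₚ.neg-distribʳ-* (f j) (g (k ∸ j))))) (sumBelow-neg (suc k) _)

∗-zeroˡ : ∀ {f} g → (∀ i → f i ≡ 0ℚ) → ∀ k → (f ∗ g) k ≡ 0ℚ
∗-zeroˡ g f≡0 k = sumBelow-zero (suc k) (λ j _ →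
  trans (cong (_*ℚ g (k ∸ j)) (f≡0 j)) (ℚₚ.*-zeroˡ (g (k ∸ j))))

∗-identityˡ : ∀ f → δ ∗ f ≗ f
∗-identityˡ f zero    = trans (ℚₚ.+-identityˡ (1ℚ *ℚ f 0)) (ℚₚ.*-identityˡ (f 0))
∗-identityˡ f (suc k) = begin
  (δ ∗ f) (suc k)                         ≡⟨ ∗-suc δ f k ⟩
  1ℚ *ℚ f (suc k) +ℚ (shift δ ∗ f) k      ≡⟨ cong₂ _+ℚ_ (ℚₚ.*-identityˡ (f (suc k)))
                                                           (∗-zeroˡ f (λ _ → refl) k) ⟩
  f (suc k) +ℚ 0ℚ                         ≡⟨ ℚₚ.+-identityʳ (f (suc k)) ⟩
  f (suc k)                               ∎

∗-identityʳ : ∀ f → f ∗ δ ≗ f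
∗-identityʳ f k = trans (∗-comm f δ k) (∗-identityˡ f k)

∗-assoc : ∀ f g h → (f ∗ g) ∗ h ≗ f ∗ (g ∗ h)
∗-assoc f g h zero    = regroup (f 0) (g 0) (h 0)
  where
  regroup : ∀ a b c → 0ℚ +ℚ (0ℚ +ℚ a *ℚ b) *ℚ c ≡ 0ℚ +ℚ a *ℚ (0ℚ +ℚ b *ℚ c)
  regroup = solve-∀ ℚ-ring
∗-assoc f g h (suc k) = begin
  ((f ∗ g) ∗ h) (suc k)
    ≡⟨ ∗-suc (f ∗ g) h k ⟩
  (f ∗ g) 0 *ℚ h (suc k) +ℚ (shift (f ∗ g) ∗ h) k
    ≡⟨ cong ((f ∗ g) 0 *ℚ h (suc k) +ℚ_) (∗-congˡ h (∗-suc f g) k) ⟩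
  (f ∗ g) 0 *ℚ h (suc k) +ℚ ((λ i → f 0 *ℚ g (suc i) +ℚ (shift f ∗ g) i) ∗ h) k
    ≡⟨ cong ((f ∗ g) 0 *ℚ h (suc k) +ℚ_) (∗-distribʳ-+ (λ i → f 0 *ℚ g (suc i)) (shift f ∗ g) h k) ⟩
  (f ∗ g) 0 *ℚ h (suc k) +ℚ (((λ i → f 0 *ℚ g (suc i)) ∗ h) k +ℚ ((shift f ∗ g) ∗ h) k)
    ≡⟨ cong ((f ∗ g) 0 *ℚ h (suc k) +ℚ_)
         (cong₂ _+ℚ_ (∗-scalarˡ (f 0) (shift g) h k) (∗-assoc (shift f) g h k)) ⟩
  (0ℚ +ℚ f 0 *ℚ g 0) *ℚ h (suc k) +ℚ (f 0 *ℚ (shift g ∗ h) k +ℚ (shift f ∗ (g ∗ h)) k)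
    ≡⟨ regroup (f 0) (g 0) (h (suc k)) ((shift g ∗ h) k) ((shift f ∗ (g ∗ h)) k) ⟩
  f 0 *ℚ (g 0 *ℚ h (suc k) +ℚ (shift g ∗ h) k) +ℚ (shift f ∗ (g ∗ h)) k
    ≡⟨ cong (λ t → f 0 *ℚ t +ℚ (shift f ∗ (g ∗ h)) k) (∗-suc g h k) ⟨
  f 0 *ℚ (g ∗ h) (suc k) +ℚ (shift f ∗ (g ∗ h)) k
    ≡⟨ ∗-suc f (g ∗ h) k ⟨
  (f ∗ (g ∗ h)) (suc k)
    ∎
  where
  regroup : ∀ a b c X Y → (0ℚ +ℚ a *ℚ b) *ℚ c +ℚ (a *ℚ X +ℚ Y) ≡ a *ℚ (b *ℚ c +ℚ X) +ℚ Y
  regroup = solve-∀ ℚ-ring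

∗-leftComm : ∀ f g h → f ∗ (g ∗ h) ≗ g ∗ (f ∗ h)
∗-leftComm f g h k = begin
  (f ∗ (g ∗ h)) k    ≡⟨ ∗-assoc f g h k ⟨
  ((f ∗ g) ∗ h) k    ≡⟨ ∗-congˡ h (∗-comm f g) k ⟩
  ((g ∗ f) ∗ h) k    ≡⟨ ∗-assoc g f h k ⟩
  (g ∗ (f ∗ h)) k    ∎

θ-∗ : ∀ f g → θ (f ∗ g) ≗ λ k → (θ f ∗ g) k +ℚ (f ∗ θ g) k
θ-∗ f g k = begin
  ℕ→ℚ k *ℚ (f ∗ g) k
    ≡⟨ *-distribˡ-sumBelow (suc k) (ℕ→ℚ k) _ ⟩
  sumBelow (suc k) (λ j → ℕ→ℚ k *ℚ (f j *ℚ g (k ∸ j)))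
    ≡⟨ sumBelow-cong (suc k) split ⟩
  sumBelow (suc k) (λ j → θ f j *ℚ g (k ∸ j) +ℚ f j *ℚ θ g (k ∸ j))
    ≡⟨ sumBelow-+ (suc k) _ _ ⟩
  (θ f ∗ g) k +ℚ (f ∗ θ g) k
    ∎
  where
  distrib : ∀ a b F G → (a +ℚ b) *ℚ (F *ℚ G) ≡ (a *ℚ F) *ℚ G +ℚ F *ℚ (b *ℚ G)
  distrib = solve-∀ ℚ-ring
  split : ∀ j → j < suc k → ℕ→ℚ k *ℚ (f j *ℚ g (k ∸ j)) ≡ θ f j *ℚ g (k ∸ j) +ℚ f j *ℚ θ g (k ∸ j)
  split j (s≤s j≤k) = begin
    ℕ→ℚ k *ℚ (f j *ℚ g (k ∸ j))
      ≡⟨ cong (λ t → ℕ→ℚ t *ℚ (f j *ℚ g (k ∸ j))) (ℕₚ.m+[n∸m]≡n j≤k) ⟨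
    ℕ→ℚ (j + (k ∸ j)) *ℚ (f j *ℚ g (k ∸ j))
      ≡⟨ cong (_*ℚ (f j *ℚ g (k ∸ j))) (ℕ→ℚ-homo-+ j (k ∸ j)) ⟩
    (ℕ→ℚ j +ℚ ℕ→ℚ (k ∸ j)) *ℚ (f j *ℚ g (k ∸ j))
      ≡⟨ distrib (ℕ→ℚ j) (ℕ→ℚ (k ∸ j)) (f j) (g (k ∸ j)) ⟩
    θ f j *ℚ g (k ∸ j) +ℚ f j *ℚ θ g (k ∸ j)
      ∎

θ-δ : ∀ k → θ δ k ≡ 0ℚ
θ-δ zero    = θ-zero δ
θ-δ (suc k) = ℚₚ.*-zeroʳ (ℕ→ℚ (suc k))

∗-self-odd : ∀ (f : Seq) n → (f ∗ f) (suc (2 * n))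
  ≡ sumBelow (suc n) (λ j → f j *ℚ f (suc (2 * n) ∸ j)) +ℚ sumBelow (suc n) (λ j → f j *ℚ f (suc (2 * n) ∸ j))
∗-self-odd f n = trans (cong (λ t → sumBelow t g) (cong suc (sym n+1+n≡m)))
  (sumBelow-palindrome (suc n) g palindromic)
  where
  m : ℕ
  m = suc (2 * n)
  g : ℕ → ℚ
  g j = f j *ℚ f (m ∸ j)
  n+1+n≡m : n + suc n ≡ m
  n+1+n≡m = trans (ℕₚ.+-suc n n) (cong (λ t → suc (n + t)) (sym (ℕₚ.+-identityʳ n)))
  palindromic : ∀ k → k < suc n → g (suc n + suc n ∸ suc k) ≡ g k
  palindromic k (s≤s k≤n) = begin
    g (n + suc n ∸ k)              ≡⟨ cong (λ t → g (t ∸ k)) n+1+n≡m ⟩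
    f (m ∸ k) *ℚ f (m ∸ (m ∸ k))   ≡⟨ cong (λ t → f (m ∸ k) *ℚ f t) (ℕₚ.m∸[m∸n]≡n k≤m) ⟩
    f (m ∸ k) *ℚ f k               ≡⟨ ℚₚ.*-comm (f (m ∸ k)) (f k) ⟩
    g k                            ∎
    where
    k≤m : k ≤ m
    k≤m = ℕₚ.≤-trans k≤n (ℕₚ.≤-trans (ℕₚ.m≤m+n n (n + 0)) (ℕₚ.n≤1+n (2 * n)))

logarithmicDerivative-square : ∀ {H A P} → H ∗ A ≗ δ → P ∗ H ≗ θ H → P ∗ P ≗ λ k → -ℚ (θ A ∗ θ H) k
logarithmicDerivative-square {H} {A} {P} H∗A≗δ P∗H≗θH k = begin
  (P ∗ P) k                      ≡⟨ ∗-congˡ P P≗θH∗A k ⟩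
  ((θ H ∗ A) ∗ P) k              ≡⟨ ∗-assoc (θ H) A P k ⟩
  (θ H ∗ (A ∗ P)) k              ≡⟨ ∗-congʳ (θ H) A∗P≗-θA k ⟩
  (θ H ∗ (λ i → -ℚ θ A i)) k     ≡⟨ ∗-negʳ (θ H) (θ A) k ⟩
  -ℚ (θ H ∗ θ A) k               ≡⟨ cong -ℚ_ (∗-comm (θ H) (θ A) k) ⟩
  -ℚ (θ A ∗ θ H) k               ∎
  where
  P≗θH∗A : P ≗ θ H ∗ A
  P≗θH∗A i = begin
    P i               ≡⟨ ∗-identityʳ P i ⟨
    (P ∗ δ) i         ≡⟨ ∗-congʳ P H∗A≗δ i ⟨
    (P ∗ (H ∗ A)) i   ≡⟨ ∗-assoc P H A i ⟨
    ((P ∗ H) ∗ A) i   ≡⟨ ∗-congˡ A P∗H≗θH i ⟩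
    (θ H ∗ A) i       ∎
  θH∗A≗-H∗θA : θ H ∗ A ≗ λ i → -ℚ (H ∗ θ A) i
  θH∗A≗-H∗θA i = inverseˡ-unique ((θ H ∗ A) i) ((H ∗ θ A) i) (begin
    (θ H ∗ A) i +ℚ (H ∗ θ A) i   ≡⟨ θ-∗ H A i ⟨
    θ (H ∗ A) i                  ≡⟨ cong (ℕ→ℚ i *ℚ_) (H∗A≗δ i) ⟩
    θ δ i                        ≡⟨ θ-δ i ⟩
    0ℚ                           ∎)
  A∗P≗-θA : A ∗ P ≗ λ i → -ℚ θ A i
  A∗P≗-θA i = begin
    (A ∗ P) i                          ≡⟨ ∗-congʳ A (λ j → trans (P≗θH∗A j) (θH∗A≗-H∗θA j)) i ⟩
    (A ∗ (λ j → -ℚ (H ∗ θ A) j)) i     ≡⟨ ∗-negʳ A (H ∗ θ A) i ⟩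
    -ℚ (A ∗ (H ∗ θ A)) i               ≡⟨ cong -ℚ_ (∗-assoc A H (θ A) i) ⟨
    -ℚ ((A ∗ H) ∗ θ A) i               ≡⟨ cong -ℚ_ (∗-congˡ (θ A) (λ j → trans (∗-comm A H j) (H∗A≗δ j)) i) ⟩
    -ℚ (δ ∗ θ A) i                     ≡⟨ cong -ℚ_ (∗-identityˡ (θ A) i) ⟩
    -ℚ θ A i                           ∎

det-cong : ∀ n {M M′ : Fin n → Fin n → ℚ} → (∀ i j → M i j ≡ M′ i j) → det n M ≡ det n M′
det-cong zero    eq = refl
det-cong (suc n) eq = sumFin-cong (suc n) (λ j →
  cong₂ (λ a d → sign (toℕ j) *ℚ (a *ℚ d)) (eq zero j) (det-cong n (λ r c → eq (suc r) (punchIn j c))))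

det-firstColumnVanishing : ∀ n (M : Fin (suc n) → Fin (suc n) → ℚ) → (∀ r → M (suc r) zero ≡ 0ℚ) →
  det (suc n) M ≡ M zero zero *ℚ det n (λ r c → M (suc r) (suc c))

det-laterMinor≡0 : ∀ n (M : Fin (suc n) → Fin (suc n) → ℚ) → (∀ r → M (suc r) zero ≡ 0ℚ) →
  ∀ j → det n (λ r c → M (suc r) (punchIn (suc j) c)) ≡ 0ℚ

det-firstColumnVanishing n M below≡0 = begin
  det (suc n) M
    ≡⟨⟩
  1ℚ *ℚ (M zero zero *ℚ det n (λ r c → M (suc r) (suc c))) +ℚ sumFin n laterTerm
    ≡⟨ cong₂ _+ℚ_ (ℚₚ.*-identityˡ (M zero zero *ℚ det n (λ r c → M (suc r) (suc c))))
                  (sumFin-zero n laterTerm≡0) ⟩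
  M zero zero *ℚ det n (λ r c → M (suc r) (suc c)) +ℚ 0ℚ
    ≡⟨ ℚₚ.+-identityʳ (M zero zero *ℚ det n (λ r c → M (suc r) (suc c))) ⟩
  M zero zero *ℚ det n (λ r c → M (suc r) (suc c))
    ∎
  where
  laterTerm : Fin n → ℚ
  laterTerm j = sign (toℕ (suc j)) *ℚ (M zero (suc j) *ℚ det n (λ r c → M (suc r) (punchIn (suc j) c)))
  laterTerm≡0 : ∀ j → laterTerm j ≡ 0ℚ
  laterTerm≡0 j =
    trans (cong (λ d → sign (toℕ (suc j)) *ℚ (M zero (suc j) *ℚ d)) (det-laterMinor≡0 n M below≡0 j))
    (trans (cong (sign (toℕ (suc j)) *ℚ_) (ℚₚ.*-zeroʳ (M zero (suc j)))) (ℚₚ.*-zeroʳ (sign (toℕ (suc j)))))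

det-laterMinor≡0 (suc n) M below≡0 j = begin
  det (suc n) minor            ≡⟨ det-firstColumnVanishing n minor (below≡0 ∘ suc) ⟩
  M (suc zero) zero *ℚ rest    ≡⟨ cong (_*ℚ rest) (below≡0 zero) ⟩
  0ℚ *ℚ rest                   ≡⟨ ℚₚ.*-zeroˡ rest ⟩
  0ℚ                           ∎
  where
  minor : Fin (suc n) → Fin (suc n) → ℚ
  minor r c = M (suc r) (punchIn (suc j) c)
  rest : ℚ
  rest = det n (λ r c → minor (suc r) (suc c))

hSeq : ∀ {N} → (Fin N → ℚ) → Seq
hSeq x k = h k x

h-zero : ∀ {N} (x : Fin N → ℚ) → h 0 x ≡ 1ℚ
h-zero {zero}  x = refl
h-zero {suc N} x = cong (λ t → 0ℚ +ℚ 1ℚ *ℚ t) (h-zero (x ∘ suc))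

module JacobiTrudi {N : ℕ} (x : Fin N → ℚ) where

  H : Seq
  H = hSeq x

  hDiff : ℕ → ℕ → ℚ
  hDiff c       zero    = H c
  hDiff zero    (suc r) = 0ℚ
  hDiff (suc c) (suc r) = hDiff c r

  hℤ-⊖ : ∀ c r → hℤ (c ℤ.⊖ r) x ≡ hDiff c r
  hℤ-⊖ c       zero    = refl
  hℤ-⊖ zero    (suc r) = refl
  hℤ-⊖ (suc c) (suc r) = trans (cong (λ z → hℤ z x) (ℤₚ.[1+m]⊖[1+n]≡m⊖n c r)) (hℤ-⊖ c r)

  -- the Jacobi–Trudi determinant of the column (1ᵏ), that is e_k
  E : ℕ → ℚ
  E k = det k (λ r c → hDiff (suc (toℕ c)) (toℕ r))

  A : Seq
  A k = sign k *ℚ E k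

  bandMinor : ∀ b (j : Fin (suc b)) → det b (λ r c → hDiff (toℕ (punchIn j c)) (toℕ r)) ≡ E (b ∸ toℕ j)
  bandMinor b       zero    = refl
  bandMinor (suc b) (suc j) = begin
    det (suc b) (λ r c → hDiff (toℕ (punchIn (suc j) c)) (toℕ r))
      ≡⟨ det-firstColumnVanishing b (λ r c → hDiff (toℕ (punchIn (suc j) c)) (toℕ r)) (λ _ → refl) ⟩
    H 0 *ℚ det b (λ r c → hDiff (toℕ (punchIn j c)) (toℕ r))
      ≡⟨ cong₂ _*ℚ_ (h-zero x) (bandMinor b j) ⟩
    1ℚ *ℚ E (b ∸ toℕ j)
      ≡⟨ ℚₚ.*-identityˡ (E (b ∸ toℕ j)) ⟩
    E (b ∸ toℕ j)
      ∎

  signed-∗A : ∀ k (g : Seq) → sign k *ℚ sumBelow (suc k) (λ j → sign j *ℚ (g j *ℚ E (k ∸ j))) ≡ (g ∗ A) k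
  signed-∗A k g = trans (*-distribˡ-sumBelow (suc k) (sign k) _) (sumBelow-cong (suc k) absorb)
    where
    regroup : ∀ s t y e → s *ℚ (t *ℚ (y *ℚ e)) ≡ y *ℚ ((s *ℚ t) *ℚ e)
    regroup = solve-∀ ℚ-ring
    absorb : ∀ j → j < suc k → sign k *ℚ (sign j *ℚ (g j *ℚ E (k ∸ j))) ≡ g j *ℚ A (k ∸ j)
    absorb j (s≤s j≤k) = trans (regroup (sign k) (sign j) (g j) (E (k ∸ j)))
      (cong (λ s → g j *ℚ (s *ℚ E (k ∸ j))) (sign-∸ j≤k))

  E-expansion : ∀ k → E (suc k) ≡ sumBelow (suc k) (λ j → sign j *ℚ (H (suc j) *ℚ E (k ∸ j)))
  E-expansion k = trans
    (sumFin-cong (suc k) (λ j → cong (λ d → sign (toℕ j) *ℚ (H (suc (toℕ j)) *ℚ d)) (bandMinor k j)))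
    (sumFin-toℕ (suc k) (λ j → sign j *ℚ (H (suc j) *ℚ E (k ∸ j))))

  A-suc : ∀ k → A (suc k) ≡ -ℚ (shift H ∗ A) k
  A-suc k = begin
    (-ℚ sign k) *ℚ E (suc k)
      ≡⟨ ℚₚ.neg-distribˡ-* (sign k) (E (suc k)) ⟨
    -ℚ (sign k *ℚ E (suc k))
      ≡⟨ cong (λ e → -ℚ (sign k *ℚ e)) (E-expansion k) ⟩
    -ℚ (sign k *ℚ sumBelow (suc k) (λ j → sign j *ℚ (H (suc j) *ℚ E (k ∸ j))))
      ≡⟨ cong -ℚ_ (signed-∗A k (shift H)) ⟩
    -ℚ (shift H ∗ A) k
      ∎

  H∗A≗δ : H ∗ A ≗ δ
  H∗A≗δ zero    = cong (λ t → 0ℚ +ℚ t *ℚ (1ℚ *ℚ 1ℚ)) (h-zero x)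
  H∗A≗δ (suc k) = begin
    (H ∗ A) (suc k)                          ≡⟨ ∗-suc H A k ⟩
    H 0 *ℚ A (suc k) +ℚ (shift H ∗ A) k      ≡⟨ cong (λ t → t *ℚ A (suc k) +ℚ (shift H ∗ A) k) (h-zero x) ⟩
    1ℚ *ℚ A (suc k) +ℚ (shift H ∗ A) k       ≡⟨ cong (_+ℚ (shift H ∗ A) k)
                                                   (trans (ℚₚ.*-identityˡ (A (suc k))) (A-suc k)) ⟩
    -ℚ (shift H ∗ A) k +ℚ (shift H ∗ A) k    ≡⟨ ℚₚ.+-inverseˡ ((shift H ∗ A) k) ⟩
    0ℚ                                       ∎

  hook-expansion : ∀ a b → s (hook a b) x ≡ sumBelow (suc b) (λ j → sign j *ℚ (H (a + j) *ℚ E (b ∸ j)))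
  hook-expansion a b = begin
    s (hook a b) x
      ≡⟨ sumFin-cong (suc L) (λ j → cong₂ (λ y d → sign (toℕ j) *ℚ (y *ℚ d)) (firstRow (toℕ j)) (minor j)) ⟩
    sumFin (suc L) (λ j → sign (toℕ j) *ℚ (H (a + toℕ j) *ℚ E (L ∸ toℕ j)))
      ≡⟨ sumFin-toℕ (suc L) (λ j → sign j *ℚ (H (a + j) *ℚ E (L ∸ j))) ⟩
    sumBelow (suc L) (λ j → sign j *ℚ (H (a + j) *ℚ E (L ∸ j)))
      ≡⟨ cong (λ ℓ → sumBelow (suc ℓ) (λ j → sign j *ℚ (H (a + j) *ℚ E (ℓ ∸ j)))) (length-replicate b) ⟩
    sumBelow (suc b) (λ j → sign j *ℚ (H (a + j) *ℚ E (b ∸ j)))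
      ∎
    where
    L : ℕ
    L = length (replicate b 1)
    firstRow : ∀ j → hℤ ((+ a - + 0) ℤ.+ + j) x ≡ H (a + j)
    firstRow j = cong (λ t → h (t + j) x) (ℕₚ.+-identityʳ a)
    lookup-ones : ∀ n (r : Fin (length (replicate n 1))) → lookup (replicate n 1) r ≡ 1
    lookup-ones (suc n) zero    = refl
    lookup-ones (suc n) (suc r) = lookup-ones n r
    shape : ∀ r c → (+ 1 - (+ 1 ℤ.+ r)) ℤ.+ c ≡ c - r
    shape = ℤ-Solver.solve-∀
    lowerRow : ∀ r c → hℤ ((+ lookup (replicate b 1) r - + suc (toℕ r)) ℤ.+ + c) x ≡ hDiff c (toℕ r)
    lowerRow r c = begin
      hℤ ((+ lookup (replicate b 1) r - + suc (toℕ r)) ℤ.+ + c) x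
        ≡⟨ cong (λ t → hℤ ((+ t - + suc (toℕ r)) ℤ.+ + c) x) (lookup-ones b r) ⟩
      hℤ ((+ 1 - + suc (toℕ r)) ℤ.+ + c) x
        ≡⟨ cong (λ z → hℤ z x) (trans (shape (+ toℕ r) (+ c)) (ℤₚ.m-n≡m⊖n c (toℕ r))) ⟩
      hℤ (c ℤ.⊖ toℕ r) x
        ≡⟨ hℤ-⊖ c (toℕ r) ⟩
      hDiff c (toℕ r)
        ∎
    minor : ∀ j → det L (λ r c → hℤ ((+ lookup (replicate b 1) r - + suc (toℕ r)) ℤ.+ + toℕ (punchIn j c)) x)
                ≡ E (L ∸ toℕ j)
    minor j = trans (det-cong L (λ r c → lowerRow r (toℕ (punchIn j c)))) (bandMinor L j)

  hook-alternating : ∀ a b → sign b *ℚ s (hook a b) x ≡ ((λ t → H (a + t)) ∗ A) b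
  hook-alternating a b = trans (cong (sign b *ℚ_) (hook-expansion a b)) (signed-∗A b (λ t → H (a + t)))

pow-homo-+ : ∀ a m n → pow a m *ℚ pow a n ≡ pow a (m + n)
pow-homo-+ a zero    n = ℚₚ.*-identityˡ (pow a n)
pow-homo-+ a (suc m) n = trans (ℚₚ.*-assoc a (pow a m) (pow a n)) (cong (a *ℚ_) (pow-homo-+ a m n))

θ-pow : ∀ a → θ (pow a) ≗ dropConstant (pow a) ∗ pow a
θ-pow a zero    = refl
θ-pow a (suc k) = begin
  ℕ→ℚ (suc k) *ℚ pow a (suc k)
    ≡⟨ sumBelow-const (suc k) (pow a (suc k)) ⟨
  sumBelow (suc k) (λ _ → pow a (suc k))
    ≡⟨ sumBelow-cong (suc k) split ⟩
  (shift G ∗ pow a) k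
    ≡⟨ ℚₚ.+-identityˡ ((shift G ∗ pow a) k) ⟨
  0ℚ +ℚ (shift G ∗ pow a) k
    ≡⟨ cong (_+ℚ (shift G ∗ pow a) k) (ℚₚ.*-zeroˡ (pow a (suc k))) ⟨
  G 0 *ℚ pow a (suc k) +ℚ (shift G ∗ pow a) k
    ≡⟨ ∗-suc G (pow a) k ⟨
  (G ∗ pow a) (suc k)
    ∎
  where
  G : Seq
  G = dropConstant (pow a)
  split : ∀ j → j < suc k → pow a (suc k) ≡ pow a (suc j) *ℚ pow a (k ∸ j)
  split j (s≤s j≤k) = sym (trans (pow-homo-+ a (suc j) (k ∸ j)) (cong (pow a ∘ suc) (ℕₚ.m+[n∸m]≡n j≤k)))

-- p₀ x = N is dropped: Newton's identities only involve the power sums of positive degree.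
powerSums : ∀ {N} → (Fin N → ℚ) → Seq
powerSums x = dropConstant (λ k → p k x)

newton : ∀ {N} (x : Fin N → ℚ) → powerSums x ∗ hSeq x ≗ θ (hSeq x)
newton {zero}  x zero    = refl
newton {zero}  x (suc k) = trans (∗-zeroˡ (hSeq x) noPowerSums (suc k)) (sym (ℚₚ.*-zeroʳ (ℕ→ℚ (suc k))))
  where
  noPowerSums : ∀ i → powerSums x i ≡ 0ℚ
  noPowerSums zero    = refl
  noPowerSums (suc i) = refl
newton {suc N} x k = begin
  (P ∗ H) k
    ≡⟨ ∗-congʳ P split-H k ⟩
  (P ∗ (G ∗ H′)) k
    ≡⟨ ∗-congˡ (G ∗ H′) split-P k ⟩
  ((λ i → dropConstant G i +ℚ P′ i) ∗ (G ∗ H′)) k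
    ≡⟨ ∗-distribʳ-+ (dropConstant G) P′ (G ∗ H′) k ⟩
  (dropConstant G ∗ (G ∗ H′)) k +ℚ (P′ ∗ (G ∗ H′)) k
    ≡⟨ cong₂ _+ℚ_ (∗-assoc (dropConstant G) G H′ k) (∗-leftComm G P′ H′ k) ⟨
  ((dropConstant G ∗ G) ∗ H′) k +ℚ (G ∗ (P′ ∗ H′)) k
    ≡⟨ cong₂ _+ℚ_ (∗-congˡ H′ (λ i → sym (θ-pow (x zero) i)) k) (∗-congʳ G (newton (x ∘ suc)) k) ⟩
  (θ G ∗ H′) k +ℚ (G ∗ θ H′) k
    ≡⟨ θ-∗ G H′ k ⟨
  θ (G ∗ H′) k
    ≡⟨ cong (ℕ→ℚ k *ℚ_) (split-H k) ⟨
  θ H k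
    ∎
  where
  G H H′ P P′ : Seq
  G  = pow (x zero)
  H  = hSeq x
  H′ = hSeq (x ∘ suc)
  P  = powerSums x
  P′ = powerSums (x ∘ suc)
  split-H : H ≗ G ∗ H′
  split-H zero    = refl
  split-H (suc k) = refl
  split-P : P ≗ λ i → dropConstant G i +ℚ P′ i
  split-P zero    = refl
  split-P (suc i) = refl

module OddHookSum (n : ℕ) {N : ℕ} (x : Fin N → ℚ) where
  open JacobiTrudi x

  m : ℕ
  m = suc (2 * n)

  w W c : ℕ → ℚ
  w i = ℤ→ℚ (+ n - + i)
  W l = sumBelow l w
  c l = A l *ℚ H (m ∸ l)

  signedHook-partialSum : ∀ i → i < m → sign i *ℚ s (hook (m ∸ i) i) x ≡ sumBelow (suc i) c
  signedHook-partialSum i i<m = begin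
    sign i *ℚ s (hook (m ∸ i) i) x          ≡⟨ hook-alternating (m ∸ i) i ⟩
    ((λ t → H (m ∸ i + t)) ∗ A) i           ≡⟨ ∗-comm (λ t → H (m ∸ i + t)) A i ⟩
    (A ∗ (λ t → H (m ∸ i + t))) i           ≡⟨ sumBelow-cong (suc i) (λ l l<1+i →
                                                 cong (λ t → A l *ℚ H t) (index l<1+i)) ⟩
    sumBelow (suc i) c                      ∎
    where
    index : ∀ {l} → l < suc i → m ∸ i + (i ∸ l) ≡ m ∸ l
    index {l} (s≤s l≤i) = trans (sym (ℕₚ.+-∸-assoc (m ∸ i) l≤i)) (cong (_∸ l) (ℕₚ.m∸n+n≡m (ℕₚ.<⇒≤ i<m)))

  twice-tailWeight : ∀ {l} → l ≤ m → (W m -ℚ W l) +ℚ (W m -ℚ W l) ≡ -ℚ (ℕ→ℚ l *ℚ ℕ→ℚ (m ∸ l))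
  twice-tailWeight {l} l≤m = begin
    (W m -ℚ W l) +ℚ (W m -ℚ W l)
      ≡⟨ regroup (W m) (W l) ⟩
    (W m +ℚ W m) -ℚ (W l +ℚ W l)
      ≡⟨ cong₂ _-ℚ_ (twice-Σ[n-i] n m) (twice-Σ[n-i] n l) ⟩
    ℕ→ℚ m *ℚ (ℕ→ℚ m -ℚ ℕ→ℚ m) -ℚ ℕ→ℚ l *ℚ (ℕ→ℚ m -ℚ ℕ→ℚ l)
      ≡⟨ cancel (ℕ→ℚ m) (ℕ→ℚ l) ⟩
    -ℚ (ℕ→ℚ l *ℚ (ℕ→ℚ m -ℚ ℕ→ℚ l))
      ≡⟨ cong (λ t → -ℚ (ℕ→ℚ l *ℚ t)) (ℕ→ℚ-homo-∸ l≤m) ⟨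
    -ℚ (ℕ→ℚ l *ℚ ℕ→ℚ (m ∸ l))
      ∎
    where
    regroup : ∀ a b → (a -ℚ b) +ℚ (a -ℚ b) ≡ (a +ℚ a) -ℚ (b +ℚ b)
    regroup = solve-∀ ℚ-ring
    cancel : ∀ μ ℓ → μ *ℚ (μ -ℚ μ) -ℚ ℓ *ℚ (μ -ℚ ℓ) ≡ -ℚ (ℓ *ℚ (μ -ℚ ℓ))
    cancel = solve-∀ ℚ-ring

  weightedHookSum : sumBelow m (λ i → sign i *ℚ (w i *ℚ s (hook (m ∸ i) i) x))
                  ≡ sumBelow m (λ l → c l *ℚ (W m -ℚ W l))
  weightedHookSum = trans (sumBelow-cong m signedTerm) (summation-by-parts m w c)
    where
    swap : ∀ a b d → a *ℚ (b *ℚ d) ≡ b *ℚ (a *ℚ d)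
    swap = solve-∀ ℚ-ring
    signedTerm : ∀ i → i < m → sign i *ℚ (w i *ℚ s (hook (m ∸ i) i) x) ≡ w i *ℚ sumBelow (suc i) c
    signedTerm i i<m = trans (swap (sign i) (w i) (s (hook (m ∸ i) i) x))
      (cong (w i *ℚ_) (signedHook-partialSum i i<m))

  twice-weightedHookSum : sumBelow m (λ l → c l *ℚ (W m -ℚ W l)) +ℚ sumBelow m (λ l → c l *ℚ (W m -ℚ W l))
                        ≡ -ℚ (θ A ∗ θ H) m
  twice-weightedHookSum = begin
    sumBelow m (λ l → c l *ℚ (W m -ℚ W l)) +ℚ sumBelow m (λ l → c l *ℚ (W m -ℚ W l))
      ≡⟨ sumBelow-+ m _ _ ⟨
    sumBelow m (λ l → c l *ℚ (W m -ℚ W l) +ℚ c l *ℚ (W m -ℚ W l))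
      ≡⟨ sumBelow-cong m (λ l l<m → doubled (ℕₚ.<⇒≤ l<m)) ⟩
    sumBelow m (λ l → -ℚ (θ A l *ℚ θ H (m ∸ l)))
      ≡⟨ sumBelow-neg m (λ l → θ A l *ℚ θ H (m ∸ l)) ⟩
    -ℚ S
      ≡⟨ cong -ℚ_ lastTermVanishes ⟨
    -ℚ (θ A ∗ θ H) m
      ∎
    where
    doubled : ∀ {l} → l ≤ m → c l *ℚ (W m -ℚ W l) +ℚ c l *ℚ (W m -ℚ W l) ≡ -ℚ (θ A l *ℚ θ H (m ∸ l))
    doubled {l} l≤m = begin
      c l *ℚ (W m -ℚ W l) +ℚ c l *ℚ (W m -ℚ W l)
        ≡⟨ ℚₚ.*-distribˡ-+ (c l) (W m -ℚ W l) (W m -ℚ W l) ⟨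
      c l *ℚ ((W m -ℚ W l) +ℚ (W m -ℚ W l))
        ≡⟨ cong (c l *ℚ_) (twice-tailWeight l≤m) ⟩
      (A l *ℚ H (m ∸ l)) *ℚ -ℚ (ℕ→ℚ l *ℚ ℕ→ℚ (m ∸ l))
        ≡⟨ regroup (A l) (H (m ∸ l)) (ℕ→ℚ l) (ℕ→ℚ (m ∸ l)) ⟩
      -ℚ (θ A l *ℚ θ H (m ∸ l))
        ∎
      where
      regroup : ∀ a y ι κ → (a *ℚ y) *ℚ -ℚ (ι *ℚ κ) ≡ -ℚ ((ι *ℚ a) *ℚ (κ *ℚ y))
      regroup = solve-∀ ℚ-ring
    S : ℚ
    S = sumBelow m (λ l → θ A l *ℚ θ H (m ∸ l))
    lastTermVanishes : (θ A ∗ θ H) m ≡ S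
    lastTermVanishes = begin
      S +ℚ θ A m *ℚ θ H (m ∸ m)   ≡⟨ cong (λ t → S +ℚ θ A m *ℚ t)
                                         (trans (cong (θ H) (ℕₚ.n∸n≡0 m)) (θ-zero H)) ⟩
      S +ℚ θ A m *ℚ 0ℚ            ≡⟨ cong (S +ℚ_) (ℚₚ.*-zeroʳ (θ A m)) ⟩
      S +ℚ 0ℚ                     ≡⟨ ℚₚ.+-identityʳ S ⟩
      S                           ∎

  powerSums-square : (powerSums x ∗ powerSums x) m
                   ≡ sumFromTo 1 n (λ i → pPart (m ∸ i ∷ i ∷ []) x)
                     +ℚ sumFromTo 1 n (λ i → pPart (m ∸ i ∷ i ∷ []) x)
  powerSums-square = trans (∗-self-odd P n) (cong₂ _+ℚ_ half half)
    where
    P : Seq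
    P = powerSums x
    term : ∀ k → k < n → P (suc k) *ℚ P (m ∸ suc k) ≡ p (m ∸ suc k) x *ℚ (p (suc k) x *ℚ 1ℚ)
    term k k<n = trans (cong (p (suc k) x *ℚ_) (dropConstant-pos (λ j → p j x) (ℕₚ.m<n⇒0<n∸m 1+k<m)))
      (trans (ℚₚ.*-comm (p (suc k) x) (p (m ∸ suc k) x))
        (cong (p (m ∸ suc k) x *ℚ_) (sym (ℚₚ.*-identityʳ (p (suc k) x)))))
      where
      1+k<m : suc k < m
      1+k<m = s≤s (ℕₚ.≤-trans k<n (ℕₚ.m≤m+n n (n + 0)))
    half : sumBelow (suc n) (λ j → P j *ℚ P (m ∸ j)) ≡ sumFromTo 1 n (λ i → pPart (m ∸ i ∷ i ∷ []) x)
    half = begin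
      sumBelow (suc n) (λ j → P j *ℚ P (m ∸ j))
        ≡⟨ sumBelow-suc n (λ j → P j *ℚ P (m ∸ j)) ⟩
      0ℚ *ℚ P m +ℚ sumBelow n (λ k → P (suc k) *ℚ P (m ∸ suc k))
        ≡⟨ cong (_+ℚ sumBelow n (λ k → P (suc k) *ℚ P (m ∸ suc k))) (ℚₚ.*-zeroˡ (P m)) ⟩
      0ℚ +ℚ sumBelow n (λ k → P (suc k) *ℚ P (m ∸ suc k))
        ≡⟨ ℚₚ.+-identityˡ _ ⟩
      sumBelow n (λ k → P (suc k) *ℚ P (m ∸ suc k))
        ≡⟨ sumBelow-cong n term ⟩
      sumFromTo 1 n (λ i → pPart (m ∸ i ∷ i ∷ []) x)
        ∎

theorem1 : (n : ℕ) (N : ℕ) (x : Fin N → ℚ) →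
    (sumFromTo 0 (2 * n) (λ i → sign i *ℚ (ℤ→ℚ (+ n - + i) *ℚ s (hook (suc (2 * n) ∸ i) i) x))
      ≡ sumFromTo 1 n (λ i → pPart (suc (2 * n) ∸ i ∷ i ∷ []) x))
    × (sumFromTo 1 n (λ i → pPart (suc (2 * n) ∸ i ∷ i ∷ []) x)
      ≡ sumFromTo 1 n (λ i → p (suc (2 * n) ∸ i) x *ℚ p i x))
theorem1 n N x = double-injective (begin
    hookSum +ℚ hookSum
      ≡⟨ cong₂ _+ℚ_ weightedHookSum weightedHookSum ⟩
    abelSum +ℚ abelSum
      ≡⟨ twice-weightedHookSum ⟩
    -ℚ (θ A ∗ θ H) m
      ≡⟨ logarithmicDerivative-square {P = powerSums x} H∗A≗δ (newton x) m ⟨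
    (powerSums x ∗ powerSums x) m
      ≡⟨ powerSums-square ⟩
    sumFromTo 1 n (λ i → pPart (m ∸ i ∷ i ∷ []) x) +ℚ sumFromTo 1 n (λ i → pPart (m ∸ i ∷ i ∷ []) x)
      ∎)
  , sumBelow-cong n (λ k _ → cong (p (m ∸ suc k) x *ℚ_) (ℚₚ.*-identityʳ (p (suc k) x)))
  where
  open OddHookSum n x
  open JacobiTrudi x
  hookSum abelSum : ℚ
  hookSum = sumBelow m (λ i → sign i *ℚ (w i *ℚ s (hook (m ∸ i) i) x))
  abelSum = sumBelow m (λ l → c l *ℚ (W m -ℚ W l))
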